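{- Let $\mathcal H=(V,E)$ be an $r$-uniform hypergraph with $n$ vertices and $m\ge 5$ edges, let $\eta$ be a bijection from $E$ to $[m]$, let $e\in E$ and let $k$ be a positive integer. Then for any integer $i$ with $2\le i\le m/2$, $$\sum_{A\in\mathcal{NB}_{2i-1}(\mathcal H,e)}\frac{k^{c(A)-1-(n-r)}}{2i-1}-\sum_{A\in\mathcal{NB}_{2i}(\mathcal H,e)}k^{c(A)-1-(n-r)}\ge -\frac{(m-2i)\,|\mathcal{NB}_{2i}(\mathcal H,e)|}{m-2i+1}\,k^{ -2i+1}.$$
   Context: Hypergraphs are finite; every edge has at least $2$ vertices and no edge is contained in another; $\mathcal H$ is $r$-uniform if all edges have exactly $r$ vertices. $[m]=\{1,\dots,m\}$. For $A\subseteq E$, $c(A)$ is the number of connected components of the spanning subhypergraph $(V,A)$. For $F\subseteq E$, $V(F)=\bigcup_{e\in F}e$. A $\delta$-cycle is a minimal edge set $F$ such that $e\subseteq V(F\setminus\{e\})$ for every $e\in F$. A broken-$\delta$-cycle (w.r.t. $\eta$) is obtained from a $\delta$-cycle $C$ by deleting its edge with smallest $\eta$-value. $\mathcal{NB}(\mathcal H)$ is the set of subsets of $E$ containing no broken-$\delta$-cycle; $\mathcal{NB}_j(\mathcal H,e)$ is the set of $A\in\mathcal{NB}(\mathcal H)$ with $e\in A$ and $|A|=j$. -}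

module Defs where

open import Data.Nat as ℕ using (ℕ; zero; suc; NonZero)
open import Data.Nat.Properties using (m^n≢0)
open import Data.Integer as ℤ using (ℤ; +_; -[1+_])
open import Data.Rational as ℚ using (ℚ; 0ℚ)
open import Data.Fin as Fin using (Fin)
open import Data.Fin.Subset using (Subset; _∈_; _⊆_; _-_; ∣_∣; Nonempty)
open import Data.List using (List; foldr)
import Data.List.Membership.Propositional as LM
open import Data.List.Relation.Unary.Unique.Propositional using (Unique)
open import Data.Product using (Σ; ∃; _×_; _,_)
open import Relation.Binary.PropositionalEquality using (_≡_; _≢_)
open import Relation.Binary.Construct.Closure.ReflexiveTransitive using (Star)
open import Relation.Nullary using (¬_)

-- A hypergraph with vertex set V = Fin n and edge set E indexed by Fin m:
-- edge j : Subset n is the vertex set of the j-th edge.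
-- Sets of edges (A ⊆ E) are Subset m.

IsUniform : ∀ {n m} → (Fin m → Subset n) → ℕ → Set
IsUniform edge r = ∀ j → ∣ edge j ∣ ≡ r

EdgesAtLeast2 : ∀ {n m} → (Fin m → Subset n) → Set
EdgesAtLeast2 edge = ∀ j → 2 ℕ.≤ ∣ edge j ∣

Sperner : ∀ {n m} → (Fin m → Subset n) → Set
Sperner edge = ∀ j j′ → edge j ⊆ edge j′ → j ≡ j′

Adj : ∀ {n m} → (Fin m → Subset n) → Subset m → Fin n → Fin n → Set
Adj edge A v w = ∃ λ j → j ∈ A × v ∈ edge j × w ∈ edge j

Conn : ∀ {n m} → (Fin m → Subset n) → Subset m → Fin n → Fin n → Set
Conn edge A = Star (Adj edge A)

-- c is the number of connected components of (V, A): there is a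
-- surjection V → Fin c whose fibres are exactly the components.
IsNumComponents : ∀ {n m} → (Fin m → Subset n) → Subset m → ℕ → Set
IsNumComponents {n} edge A c =
  Σ (Fin n → Fin c) λ f →
    (∀ y → ∃ λ x → f x ≡ y) ×
    (∀ v w → (f v ≡ f w → Conn edge A v w) × (Conn edge A v w → f v ≡ f w))

InVWithout : ∀ {n m} → (Fin m → Subset n) → Subset m → Fin m → Fin n → Set
InVWithout edge F j v = ∃ λ j′ → j′ ∈ F × j′ ≢ j × v ∈ edge j′

DeltaCond : ∀ {n m} → (Fin m → Subset n) → Subset m → Set
DeltaCond edge F = ∀ j → j ∈ F → ∀ v → v ∈ edge j → InVWithout edge F j v

IsDeltaCycle : ∀ {n m} → (Fin m → Subset n) → Subset m → Set
IsDeltaCycle edge F =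
  Nonempty F × DeltaCond edge F ×
  (∀ F′ → F′ ⊆ F → Nonempty F′ → DeltaCond edge F′ → F ⊆ F′)

IsBrokenDeltaCycle : ∀ {n m} → (Fin m → Subset n) → (Fin m → Fin m) → Subset m → Set
IsBrokenDeltaCycle edge η B =
  ∃ λ C → IsDeltaCycle edge C × ∃ λ j → j ∈ C × (∀ j′ → j′ ∈ C → η j Fin.≤ η j′) × B ≡ C - j

IsNB : ∀ {n m} → (Fin m → Subset n) → (Fin m → Fin m) → Subset m → Set
IsNB edge η A = ∀ B → IsBrokenDeltaCycle edge η B → ¬ (B ⊆ A)

IsNBj : ∀ {n m} → (Fin m → Subset n) → (Fin m → Fin m) → ℕ → Fin m → Subset m → Set
IsNBj edge η j e A = IsNB edge η A × e ∈ A × ∣ A ∣ ≡ j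

-- Finite sets of edge sets, represented by duplicate-free lists

Enumerates : ∀ {m} → (Subset m → Set) → List (Subset m) → Set
Enumerates P L = Unique L × (∀ A → (A LM.∈ L → P A) × (P A → A LM.∈ L))

sumℚ : List ℚ → ℚ
sumℚ = foldr ℚ._+_ 0ℚ

kpow : (k : ℕ) → .{{NonZero k}} → ℤ → ℚ
kpow k (+ p) = (+ (k ℕ.^ p)) ℚ./ 1
kpow k -[1+ p ] = (+ 1) ℚ./ (k ℕ.^ suc p)
  where instance _ = m^n≢0 k (suc p)

-- Write w(A) = k ^ (c(A) - 1 - (n - r)) and S_j for the sum of w over NB_j(H, e).
--
-- A nonempty NB set A has an edge with a private vertex: otherwise A satisfies the
-- δ-condition, so it contains a δ-cycle, and the corresponding broken δ-cycle lies in A.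
-- Deleting such an edge splits off that vertex, and a single edge leaves at most
-- n - r + 1 components, so c(A) ≤ n - r + 2 - |A| and w(A) ≤ k ^ (1 - 2i) on NB_2i.
--
-- Deleting any f ≠ e from A ∈ NB_2i(H, e) gives A - f ∈ NB_(2i-1)(H, e) with
-- w(A - f) ≥ w(A), and B ∈ NB_(2i-1)(H, e) arises from at most m - 2i + 1 pairs (A, f),
-- so (2i - 1) S_2i ≤ (m - 2i + 1) S_(2i-1).  Hence
-- S_(2i-1) / (2i - 1) - S_2i ≥ - S_2i (m - 2i) / (m - 2i + 1), and the first bound finishes.

module Submission where

open import Defs
open import Data.Nat as ℕ using (ℕ; suc; NonZero; _∸_)
open import Data.Integer as ℤ using (+_)
open import Data.Rational as ℚ using (ℚ)
open import Data.Fin using (Fin)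
open import Data.Fin.Subset using (Subset)
open import Data.List using (List; map; length)
open import Function.Definitions using (Bijective)
open import Relation.Binary.PropositionalEquality using (_≡_)

open import Data.Nat using (zero; z≤n; s≤s)
import Data.Nat.Properties as ℕP
open import Data.Nat.Solver using (module +-*-Solver)
open import Data.Integer using (ℤ; -[1+_])
import Data.Integer.Properties as ℤP
import Data.Integer.Solver as ℤSolver
open import Data.Rational using (0ℚ; 1ℚ)
import Data.Rational.Properties as ℚP
import Data.Rational.Unnormalised as ℚᵘ
import Data.Rational.Unnormalised.Properties as ℚᵘP
import Data.Rational.Solver as ℚSolver
open import Data.Bool using (Bool; true; false; if_then_else_)
open import Data.Vec using ([]; _∷_; head; tail; lookup; here; there)
open import Data.Vec.Properties using ([]=⇒lookup; lookup⇒[]=)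
open import Data.Fin using (zero; suc; toℕ; _≟_)
open import Data.Fin.Properties using (any?; all?; injective⇒≤; suc-injective; 0≢1+n)
open import Data.Fin.Subset using (_∈_; _∉_; ∣_∣; _⊆_; _⊂_; _-_; ∁; ⁅_⁆; Nonempty)
open import Data.Fin.Subset.Properties
  using (_∈?_; _⊂?_; nonempty?; anySubset?; ⊆-trans; p─q⊆p; x∈p∧x≢y⇒x∈p-y; x∈p⇒∣p-x∣<∣p∣;
         x∉p⇒x∈∁p; ∣∁p∣≡n∸∣p∣; ∣p∣≤n; ∣⁅x⁆∣≡1; x∈⁅y⁆⇒x≡y; p─⊥≡p; Empty-unique; ∣⊥∣≡0)
open import Data.Fin.Subset.Induction using (⊂-wellFounded; Acc; acc)
open import Data.Nat.Induction using (<-wellFounded)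
import Relation.Binary.Construct.On as On
open import Data.List using ([]; _∷_; _++_)
open import Data.List.Membership.Propositional using () renaming (_∈_ to _∈ₗ_)
open import Data.List.Membership.Propositional.Properties using (∈-∃++; ∈-++⁻; ∈-++⁺ˡ; ∈-++⁺ʳ)
open import Data.List.Relation.Unary.Any using (here; there)
import Data.List.Relation.Unary.All as All
open import Data.List.Relation.Unary.AllPairs using (_∷_)
open import Data.List.Relation.Unary.Unique.Propositional using (Unique)
open import Data.Product using (∃; _×_; _,_; proj₁; proj₂)
open import Data.Sum using (_⊎_; inj₁; inj₂)
open import Data.Empty using (⊥-elim)
open import Function using (id; _∘_; _on_)
open import Function.Definitions using (Injective; StrictlySurjective)
open import Relation.Nullary using (¬_; yes; no; Dec)
open import Relation.Nullary.Decidable using (_×-dec_; _→-dec_; ¬?; decidable-stable)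
open import Relation.Unary using (Pred; Decidable)
open import Relation.Binary.PropositionalEquality
  using (_≢_; refl; sym; trans; cong; cong₂; subst; subst₂; ≢-sym; module ≡-Reasoning)
open import Relation.Binary.Construct.Closure.ReflexiveTransitive using (ε; _◅_)
import Relation.Binary.Construct.Closure.ReflexiveTransitive as Star
open import Algebra.Properties.CommutativeMonoid.Sum ℚP.+-0-commutativeMonoid
  using (sum; ∑-distrib-+; sum-replicate-zero)

toℚ : ℕ → ℚ
toℚ a = + a ℚ./ 1

private
  toℚᵘ-/ : ∀ a b → ℚ.toℚᵘ (+ a ℚ./ suc b) ℚᵘ.≃ ℚᵘ.mkℚᵘ (+ a) b
  toℚᵘ-/ a b = ℚP.toℚᵘ-fromℚᵘ (ℚᵘ.mkℚᵘ (+ a) b)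

*≤*⇒/≤/ : ∀ a d a′ d′ .{{_ : NonZero d}} .{{_ : NonZero d′}} →
          a ℕ.* d′ ℕ.≤ a′ ℕ.* d → + a ℚ./ d ℚ.≤ + a′ ℚ./ d′
*≤*⇒/≤/ a (suc b) a′ (suc b′) h = ℚP.toℚᵘ-cancel-≤
  (ℚᵘP.≤-respˡ-≃ (ℚᵘP.≃-sym (toℚᵘ-/ a b)) (ℚᵘP.≤-respʳ-≃ (ℚᵘP.≃-sym (toℚᵘ-/ a′ b′))
    (ℚᵘ.*≤* (subst₂ ℤ._≤_ (ℤP.pos-* a (suc b′)) (ℤP.pos-* a′ (suc b)) (ℤ.+≤+ h)))))

*≡*⇒/≡/ : ∀ a d a′ d′ .{{_ : NonZero d}} .{{_ : NonZero d′}} →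
          a ℕ.* d′ ≡ a′ ℕ.* d → + a ℚ./ d ≡ + a′ ℚ./ d′
*≡*⇒/≡/ a (suc b) a′ (suc b′) h = ℚP.fromℚᵘ-cong {ℚᵘ.mkℚᵘ (+ a) b} {ℚᵘ.mkℚᵘ (+ a′) b′}
  (ℚᵘ.*≡* (subst₂ _≡_ (ℤP.pos-* a (suc b′)) (ℤP.pos-* a′ (suc b)) (cong +_ h)))

/-*-/ : ∀ a b a′ b′ →
        (+ a ℚ./ suc b) ℚ.* (+ a′ ℚ./ suc b′) ≡ + (a ℕ.* a′) ℚ./ (suc b ℕ.* suc b′)
/-*-/ a b a′ b′ = ℚP.toℚᵘ-injective (begin
  ℚ.toℚᵘ ((+ a ℚ./ suc b) ℚ.* (+ a′ ℚ./ suc b′))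
    ≈⟨ ℚP.toℚᵘ-homo-* (+ a ℚ./ suc b) (+ a′ ℚ./ suc b′) ⟩
  ℚ.toℚᵘ (+ a ℚ./ suc b) ℚᵘ.* ℚ.toℚᵘ (+ a′ ℚ./ suc b′)
    ≈⟨ ℚᵘP.*-cong (toℚᵘ-/ a b) (toℚᵘ-/ a′ b′) ⟩
  + a ℤ.* + a′ ℚᵘ./ (suc b ℕ.* suc b′)
    ≡⟨ cong (ℚᵘ._/ (suc b ℕ.* suc b′)) (sym (ℤP.pos-* a a′)) ⟩
  + (a ℕ.* a′) ℚᵘ./ (suc b ℕ.* suc b′)
    ≈⟨ ℚᵘP.≃-sym (toℚᵘ-/ (a ℕ.* a′) (b′ ℕ.+ b ℕ.* suc b′)) ⟩
  ℚ.toℚᵘ (+ (a ℕ.* a′) ℚ./ (suc b ℕ.* suc b′)) ∎)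
  where open ℚᵘP.≃-Reasoning

toℚ-+ : ∀ a a′ → toℚ (a ℕ.+ a′) ≡ toℚ a ℚ.+ toℚ a′
toℚ-+ a a′ = ℚP.toℚᵘ-injective (begin
  ℚ.toℚᵘ (toℚ (a ℕ.+ a′))                ≈⟨ toℚᵘ-/ (a ℕ.+ a′) 0 ⟩
  + (a ℕ.+ a′) ℚᵘ./ 1                   ≡⟨ cong (ℚᵘ._/ 1) (pos-+-*1 a a′) ⟩
  ℚᵘ.mkℚᵘ (+ a) 0 ℚᵘ.+ ℚᵘ.mkℚᵘ (+ a′) 0  ≈⟨ ℚᵘP.+-cong (toℚᵘ-/ a 0) (toℚᵘ-/ a′ 0) ⟨
  ℚ.toℚᵘ (toℚ a) ℚᵘ.+ ℚ.toℚᵘ (toℚ a′)    ≈⟨ ℚP.toℚᵘ-homo-+ (toℚ a) (toℚ a′) ⟨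
  ℚ.toℚᵘ (toℚ a ℚ.+ toℚ a′)              ∎)
  where
  open ℚᵘP.≃-Reasoning
  pos-+-*1 : ∀ a a′ → + (a ℕ.+ a′) ≡ + a ℤ.* + 1 ℤ.+ + a′ ℤ.* + 1
  pos-+-*1 a a′ = trans (ℤP.pos-+ a a′) (sym (cong₂ ℤ._+_ (ℤP.*-identityʳ (+ a)) (ℤP.*-identityʳ (+ a′))))

0≤/ : ∀ a d .{{_ : NonZero d}} → 0ℚ ℚ.≤ + a ℚ./ d
0≤/ a d = *≤*⇒/≤/ 0 1 a d z≤n

toℚ-mono-≤ : ∀ {a b} → a ℕ.≤ b → toℚ a ℚ.≤ toℚ b
toℚ-mono-≤ {a} {b} a≤b = *≤*⇒/≤/ a 1 b 1 (subst₂ ℕ._≤_ (sym (ℕP.*-identityʳ a)) (sym (ℕP.*-identityʳ b)) a≤b)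

toℚ-suc : ∀ a → toℚ (suc a) ≡ 1ℚ ℚ.+ toℚ a
toℚ-suc = toℚ-+ 1

toℚ-suc-* : ∀ a x → toℚ (suc a) ℚ.* x ≡ x ℚ.+ toℚ a ℚ.* x
toℚ-suc-* a x = begin
  toℚ (suc a) ℚ.* x          ≡⟨ cong (ℚ._* x) (toℚ-suc a) ⟩
  (1ℚ ℚ.+ toℚ a) ℚ.* x       ≡⟨ ℚP.*-distribʳ-+ x 1ℚ (toℚ a) ⟩
  1ℚ ℚ.* x ℚ.+ toℚ a ℚ.* x   ≡⟨ cong (ℚ._+ toℚ a ℚ.* x) (ℚP.*-identityˡ x) ⟩
  x ℚ.+ toℚ a ℚ.* x          ∎
  where open ≡-Reasoning

1+toℚ-*-inverse : ∀ a → (1ℚ ℚ.+ toℚ a) ℚ.* (+ 1 ℚ./ suc a) ≡ 1ℚ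
1+toℚ-*-inverse a = begin
  (1ℚ ℚ.+ toℚ a) ℚ.* (+ 1 ℚ./ suc a)   ≡⟨ cong (ℚ._* (+ 1 ℚ./ suc a)) (toℚ-suc a) ⟨
  toℚ (suc a) ℚ.* (+ 1 ℚ./ suc a)      ≡⟨ /-*-/ (suc a) 0 1 a ⟩
  + (suc a ℕ.* 1) ℚ./ (1 ℕ.* suc a)    ≡⟨ *≡*⇒/≡/ (suc a ℕ.* 1) (1 ℕ.* suc a) 1 1 eq ⟩
  1ℚ                                   ∎
  where
  open ≡-Reasoning
  open +-*-Solver
  eq : suc a ℕ.* 1 ℕ.* 1 ≡ 1 ℕ.* (1 ℕ.* suc a)
  eq = solve 1 (λ a → (con 1 :+ a) :* con 1 :* con 1 := con 1 :* (con 1 :* (con 1 :+ a))) refl a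

/suc-as-* : ∀ a b d → + (a ℕ.* b) ℚ./ suc d ≡ toℚ a ℚ.* toℚ b ℚ.* (+ 1 ℚ./ suc d)
/suc-as-* a b d = sym (begin
  toℚ a ℚ.* toℚ b ℚ.* (+ 1 ℚ./ suc d)            ≡⟨ cong (ℚ._* (+ 1 ℚ./ suc d)) (/-*-/ a 0 b 0) ⟩
  + (a ℕ.* b) ℚ./ 1 ℚ.* (+ 1 ℚ./ suc d)          ≡⟨ /-*-/ (a ℕ.* b) 0 1 d ⟩
  + (a ℕ.* b ℕ.* 1) ℚ./ (1 ℕ.* suc d)            ≡⟨ *≡*⇒/≡/ (a ℕ.* b ℕ.* 1) (1 ℕ.* suc d) (a ℕ.* b) (suc d) eq ⟩
  + (a ℕ.* b) ℚ./ suc d                          ∎)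
  where
  open ≡-Reasoning
  open +-*-Solver
  eq : a ℕ.* b ℕ.* 1 ℕ.* suc d ≡ a ℕ.* b ℕ.* (1 ℕ.* suc d)
  eq = solve 3 (λ a b d → a :* b :* con 1 :* (con 1 :+ d) := a :* b :* (con 1 :* (con 1 :+ d))) refl a b d

kpow-nonNeg : ∀ k .{{_ : NonZero k}} z → 0ℚ ℚ.≤ kpow k z
kpow-nonNeg k (+ p)    = 0≤/ (k ℕ.^ p) 1
kpow-nonNeg k -[1+ p ] = 0≤/ 1 (k ℕ.^ suc p) {{ℕP.m^n≢0 k (suc p)}}

kpow-mono-≤ : ∀ k .{{_ : NonZero k}} {z z′} → z ℤ.≤ z′ → kpow k z ℚ.≤ kpow k z′
kpow-mono-≤ k (ℤ.+≤+ p≤p′) = toℚ-mono-≤ (ℕP.^-monoʳ-≤ k p≤p′)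
kpow-mono-≤ k (ℤ.-≤+ {p} {p′}) = *≤*⇒/≤/ 1 (k ℕ.^ suc p) (k ℕ.^ p′) 1 {{ℕP.m^n≢0 k (suc p)}}
  (ℕP.*-mono-≤ (ℕP.m^n>0 k p′) (ℕP.m^n>0 k (suc p)))
kpow-mono-≤ k (ℤ.-≤- {p} {p′} p′≤p) = *≤*⇒/≤/ 1 (k ℕ.^ suc p) 1 (k ℕ.^ suc p′)
  {{ℕP.m^n≢0 k (suc p)}} {{ℕP.m^n≢0 k (suc p′)}} (ℕP.*-monoʳ-≤ 1 (ℕP.^-monoʳ-≤ k (s≤s p′≤p)))

listSum : {X : Set} → List X → (X → ℚ) → ℚ
listSum L g = sumℚ (map g L)

infixl 10 listSum
syntax listSum L (λ x → g) = ∑[ x ∈ L ] g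

∑-mono-≤ : ∀ {X : Set} (L : List X) {g h : X → ℚ} → (∀ {x} → x ∈ₗ L → g x ℚ.≤ h x) →
           ∑[ x ∈ L ] g x ℚ.≤ ∑[ x ∈ L ] h x
∑-mono-≤ []      g≤h = ℚP.≤-refl
∑-mono-≤ (x ∷ L) g≤h = ℚP.+-mono-≤ (g≤h (here refl)) (∑-mono-≤ L (g≤h ∘ there))

∑-nonNeg : ∀ {X : Set} (L : List X) {g : X → ℚ} → (∀ x → 0ℚ ℚ.≤ g x) → 0ℚ ℚ.≤ ∑[ x ∈ L ] g x
∑-nonNeg []      0≤g = ℚP.≤-refl
∑-nonNeg (x ∷ L) 0≤g = ℚP.+-mono-≤ (0≤g x) (∑-nonNeg L 0≤g)

∑-++ : ∀ {X : Set} (L L′ : List X) (g : X → ℚ) →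
       ∑[ x ∈ L ++ L′ ] g x ≡ ∑[ x ∈ L ] g x ℚ.+ ∑[ x ∈ L′ ] g x
∑-++ []      L′ g = sym (ℚP.+-identityˡ _)
∑-++ (x ∷ L) L′ g = trans (cong (g x ℚ.+_) (∑-++ L L′ g)) (sym (ℚP.+-assoc (g x) _ _))

*-distribˡ-∑ : ∀ {X : Set} (L : List X) (c : ℚ) (g : X → ℚ) →
               c ℚ.* ∑[ x ∈ L ] g x ≡ ∑[ x ∈ L ] (c ℚ.* g x)
*-distribˡ-∑ []      c g = ℚP.*-zeroʳ c
*-distribˡ-∑ (x ∷ L) c g = trans (ℚP.*-distribˡ-+ c (g x) _) (cong (c ℚ.* g x ℚ.+_) (*-distribˡ-∑ L c g))

∑-const : ∀ {X : Set} (L : List X) (K : ℚ) → ∑[ x ∈ L ] K ≡ toℚ (length L) ℚ.* K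
∑-const []      K = sym (ℚP.*-zeroˡ K)
∑-const (x ∷ L) K = trans (cong (K ℚ.+_) (∑-const L K)) (sym (toℚ-suc-* (length L) K))

sum-mono-≤ : ∀ {m} {g h : Fin m → ℚ} → (∀ f → g f ℚ.≤ h f) → sum g ℚ.≤ sum h
sum-mono-≤ {zero}  g≤h = ℚP.≤-refl
sum-mono-≤ {suc m} g≤h = ℚP.+-mono-≤ (g≤h zero) (sum-mono-≤ (g≤h ∘ suc))

∑-sum-comm : ∀ {X : Set} {m} (L : List X) (g : X → Fin m → ℚ) →
             ∑[ x ∈ L ] sum (g x) ≡ sum (λ f → ∑[ x ∈ L ] g x f)
∑-sum-comm {m = m} [] g = sym (sum-replicate-zero m)
∑-sum-comm (x ∷ L) g = trans (cong (sum (g x) ℚ.+_) (∑-sum-comm L g)) (sym (∑-distrib-+ (g x) _))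

mask : ∀ {m} → Subset m → ℚ → Fin m → ℚ
mask P x f = if lookup P f then x else 0ℚ

sum-mask : ∀ {m} (P : Subset m) (x : ℚ) → sum (mask P x) ≡ toℚ ∣ P ∣ ℚ.* x
sum-mask []          x = sym (ℚP.*-zeroˡ x)
sum-mask (true ∷ P)  x = trans (cong (x ℚ.+_) (sum-mask P x)) (sym (toℚ-suc-* ∣ P ∣ x))
sum-mask (false ∷ P) x = trans (ℚP.+-identityˡ _) (sum-mask P x)

mask-mono-≤ : ∀ {m} (P : Subset m) f {x y} → x ℚ.≤ y → mask P x f ℚ.≤ mask P y f
mask-mono-≤ P f x≤y with lookup P f
... | true  = x≤y
... | false = ℚP.≤-refl

mask-nonNeg : ∀ {m} (P : Subset m) f {x} → 0ℚ ℚ.≤ x → 0ℚ ℚ.≤ mask P x f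
mask-nonNeg P f 0≤x with lookup P f
... | true  = 0≤x
... | false = ℚP.≤-refl

∑-≤-injection : ∀ {X Y : Set} (xs : List X) (ys : List Y) (D : X → Bool) (h : X → Y) (u : X → ℚ) (W : Y → ℚ) →
  Unique xs → (∀ y → 0ℚ ℚ.≤ W y) →
  (∀ {x} → x ∈ₗ xs → D x ≡ true → h x ∈ₗ ys × u x ℚ.≤ W (h x)) →
  (∀ {x x′} → x ∈ₗ xs → x′ ∈ₗ xs → D x ≡ true → D x′ ≡ true → h x ≡ h x′ → x ≡ x′) →
  ∑[ x ∈ xs ] (if D x then u x else 0ℚ) ℚ.≤ ∑[ y ∈ ys ] W y
∑-≤-injection [] ys D h u W _ 0≤W _ _ = ∑-nonNeg ys 0≤W
∑-≤-injection (x ∷ xs) ys D h u W (x∉xs ∷ !xs) 0≤W maps inj with D x in Dx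
... | false = subst (ℚ._≤ ∑[ y ∈ ys ] W y) (sym (ℚP.+-identityˡ _))
  (∑-≤-injection xs ys D h u W !xs 0≤W (maps ∘ there) (λ x∈ x′∈ → inj (there x∈) (there x′∈)))
... | true with ∈-∃++ (proj₁ (maps (here refl) Dx))
...   | ys₁ , ys₂ , refl = begin
  u x ℚ.+ ∑[ x′ ∈ xs ] (if D x′ then u x′ else 0ℚ)
    ≤⟨ ℚP.+-mono-≤ (proj₂ (maps (here refl) Dx)) rest ⟩
  W (h x) ℚ.+ ∑[ y ∈ ys₁ ++ ys₂ ] W y             ≡⟨ cong (W (h x) ℚ.+_) (∑-++ ys₁ ys₂ W) ⟩
  W (h x) ℚ.+ (∑[ y ∈ ys₁ ] W y ℚ.+ ∑[ y ∈ ys₂ ] W y)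
    ≡⟨ solve 3 (λ a b c → a :+ (b :+ c) := b :+ (a :+ c)) refl (W (h x)) (∑[ y ∈ ys₁ ] W y) (∑[ y ∈ ys₂ ] W y) ⟩
  ∑[ y ∈ ys₁ ] W y ℚ.+ (W (h x) ℚ.+ ∑[ y ∈ ys₂ ] W y) ≡⟨ ∑-++ ys₁ (h x ∷ ys₂) W ⟨
  ∑[ y ∈ ys₁ ++ h x ∷ ys₂ ] W y                   ∎
  where
  open ℚP.≤-Reasoning
  open ℚSolver.+-*-Solver
  maps′ : ∀ {x′} → x′ ∈ₗ xs → D x′ ≡ true → h x′ ∈ₗ ys₁ ++ ys₂ × u x′ ℚ.≤ W (h x′)
  maps′ x′∈ Dx′ with maps (there x′∈) Dx′
  ... | hx′∈ , u≤W with ∈-++⁻ ys₁ hx′∈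
  ...   | inj₁ hx′∈ys₁         = ∈-++⁺ˡ hx′∈ys₁ , u≤W
  ...   | inj₂ (there hx′∈ys₂) = ∈-++⁺ʳ ys₁ hx′∈ys₂ , u≤W
  ...   | inj₂ (here hx′≡hx)   = ⊥-elim (All.lookup x∉xs x′∈ (inj (here refl) (there x′∈) Dx Dx′ (sym hx′≡hx)))
  rest = ∑-≤-injection xs (ys₁ ++ ys₂) D h u W !xs 0≤W maps′ (λ x∈ x′∈ → inj (there x∈) (there x′∈))

x∉p-x : ∀ {n} (p : Subset n) x → x ∉ p - x
x∉p-x (b ∷ p) zero    ()
x∉p-x (b ∷ p) (suc x) (there x∈p-x) = x∉p-x p x x∈p-x

x∈p-y⇒x∈p×x≢y : ∀ {n} {p : Subset n} {x y} → x ∈ p - y → x ∈ p × x ≢ y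
x∈p-y⇒x∈p×x≢y {p = p} {y = y} x∈p-y = p─q⊆p p ⁅ y ⁆ x∈p-y , λ { refl → x∉p-x p y x∈p-y }

x∈p⇒suc∣p-x∣≡∣p∣ : ∀ {n} {p : Subset n} {x} → x ∈ p → suc ∣ p - x ∣ ≡ ∣ p ∣
x∈p⇒suc∣p-x∣≡∣p∣ {p = true  ∷ p} here          = cong (λ q → suc ∣ false ∷ q ∣) (p─⊥≡p p)
x∈p⇒suc∣p-x∣≡∣p∣ {p = true  ∷ p} (there x∈p) = cong suc (x∈p⇒suc∣p-x∣≡∣p∣ x∈p)
x∈p⇒suc∣p-x∣≡∣p∣ {p = false ∷ p} (there x∈p) = x∈p⇒suc∣p-x∣≡∣p∣ x∈p

p-x≡q-x⇒p≡q : ∀ {n} {p q : Subset n} {x} → x ∈ p → x ∈ q → p - x ≡ q - x → p ≡ q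
p-x≡q-x⇒p≡q {p = true ∷ p} {true ∷ q} here here p-x≡q-x =
  cong (true ∷_) (trans (sym (p─⊥≡p p)) (trans (cong tail p-x≡q-x) (p─⊥≡p q)))
p-x≡q-x⇒p≡q {p = b ∷ p} {b′ ∷ q} (there x∈p) (there x∈q) p-x≡q-x =
  cong₂ _∷_ (cong head p-x≡q-x) (p-x≡q-x⇒p≡q x∈p x∈q (cong tail p-x≡q-x))

∣p∣>0⇒Nonempty : ∀ {n} (p : Subset n) → 0 ℕ.< ∣ p ∣ → Nonempty p
∣p∣>0⇒Nonempty {n} p 0<∣p∣ = decidable-stable (nonempty? p) λ p-empty →
  ℕP.<-irrefl (sym (trans (cong ∣_∣ (Empty-unique p-empty)) (∣⊥∣≡0 n))) 0<∣p∣

∣p∣≥2⇒∃≢ : ∀ {n} {p : Subset n} {x} → 2 ℕ.≤ ∣ p ∣ → x ∈ p → ∃ λ y → y ∈ p × y ≢ x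
∣p∣≥2⇒∃≢ {p = p} {x} 2≤∣p∣ x∈p
  with ∣p∣>0⇒Nonempty (p - x) (ℕP.≤-pred (subst (2 ℕ.≤_) (sym (x∈p⇒suc∣p-x∣≡∣p∣ x∈p)) 2≤∣p∣))
... | y , y∈p-x = y , x∈p-y⇒x∈p×x≢y y∈p-x

injective⇒≤∣p∣ : ∀ {c n} (p : Subset n) (s : Fin c → Fin n) →
                 Injective _≡_ _≡_ s → (∀ y → s y ∈ p) → c ℕ.≤ ∣ p ∣
injective⇒≤∣p∣ {zero}  p s _ _ = z≤n
injective⇒≤∣p∣ {suc c} p s s-inj s∈p = ℕP.≤-<-trans
  (injective⇒≤∣p∣ (p - s zero) (s ∘ suc) (suc-injective ∘ s-inj)
    (λ y → x∈p∧x≢y⇒x∈p-y (s∈p (suc y)) λ eq → 0≢1+n (sym (s-inj eq))))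
  (x∈p⇒∣p-x∣<∣p∣ (s∈p zero))

⊆-minimal : ∀ {n ℓ} {P : Pred (Subset n) ℓ} → Decidable P → ∀ {F} → P F →
            ∃ λ C → C ⊆ F × P C × (∀ C′ → C′ ⊆ C → P C′ → C ⊆ C′)
⊆-minimal {P = P} P? {F} PF = go F (⊂-wellFounded F) PF
  where
  go : ∀ F → Acc _⊂_ F → P F → ∃ λ C → C ⊆ F × P C × (∀ C′ → C′ ⊆ C → P C′ → C ⊆ C′)
  go F (acc rs) PF with anySubset? (λ C′ → C′ ⊂? F ×-dec P? C′)
  ... | no ∄C′ = F , id , PF , λ C′ C′⊆F PC′ {x} x∈F →
        decidable-stable (x ∈? C′) λ x∉C′ → ∄C′ (C′ , (C′⊆F , x , x∈F , x∉C′) , PC′)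
  ... | yes (C′ , C′⊂F , PC′) with go C′ (rs C′⊂F) PC′
  ...   | C , C⊆C′ , PC , C-minimal = C , ⊆-trans C⊆C′ (proj₁ C′⊂F) , PC , C-minimal

∃-argmin : ∀ {m} (μ : Fin m → ℕ) {C : Subset m} → Nonempty C →
           ∃ λ j → j ∈ C × (∀ j′ → j′ ∈ C → μ j ℕ.≤ μ j′)
∃-argmin μ {C} (j , j∈C) = go j (On.wellFounded μ <-wellFounded j) j∈C
  where
  go : ∀ j → Acc (ℕ._<_ on μ) j → j ∈ C → ∃ λ j → j ∈ C × (∀ j′ → j′ ∈ C → μ j ℕ.≤ μ j′)
  go j (acc rs) j∈C with any? (λ j′ → j′ ∈? C ×-dec μ j′ ℕ.<? μ j)
  ... | yes (j′ , j′∈C , μj′<μj) = go j′ (rs μj′<μj) j′∈C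
  ... | no ∄j′ = j , j∈C , λ j′ j′∈C → ℕP.≮⇒≥ λ μj′<μj → ∄j′ (j′ , j′∈C , μj′<μj)

module _ {a b} {g : Fin b → Fin a} (g-surj : StrictlySurjective _≡_ g) where

  surjective⇒≥ : a ℕ.≤ b
  surjective⇒≥ = injective⇒≤ {f = λ y → proj₁ (g-surj y)}
    λ {y} {y′} eq → trans (sym (proj₂ (g-surj y))) (trans (cong g eq) (proj₂ (g-surj y′)))

  -- A surjection that is constant on D ∪ {x} has a section avoiding D.
  surjective-collapse-≤ : ∀ x (D : Subset b) → (∀ {y} → y ∈ D → y ≢ x × g y ≡ g x) → a ℕ.+ ∣ D ∣ ℕ.≤ b
  surjective-collapse-≤ x D D-collapses = ℕP.m≤o∸n⇒m+n≤o a (∣p∣≤n D)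
    (subst (a ℕ.≤_) (∣∁p∣≡n∸∣p∣ D) (injective⇒≤∣p∣ (∁ D) s s-injective (λ y → x∉p⇒x∈∁p (s∉D y))))
    where
    s : Fin a → Fin b
    s y with g x ≟ y
    ... | yes _ = x
    ... | no  _ = proj₁ (g-surj y)
    g∘s : ∀ y → g (s y) ≡ y
    g∘s y with g x ≟ y
    ... | yes gx≡y = gx≡y
    ... | no  _    = proj₂ (g-surj y)
    s[gx]≡x : s (g x) ≡ x
    s[gx]≡x with g x ≟ g x
    ... | yes _     = refl
    ... | no gx≢gx = ⊥-elim (gx≢gx refl)
    s-injective : Injective _≡_ _≡_ s
    s-injective {y} {y′} eq = trans (sym (g∘s y)) (trans (cong g eq) (g∘s y′))
    s∉D : ∀ y → s y ∉ D
    s∉D y sy∈D = proj₁ (D-collapses sy∈D) (trans (cong s y≡gx) s[gx]≡x)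
      where
      y≡gx : y ≡ g x
      y≡gx = trans (sym (g∘s y)) (proj₂ (D-collapses sy∈D))

-- Connected components

module _ {n m : ℕ} (edge : Fin m → Subset n) where

  Conn-mono : ∀ {A B} → B ⊆ A → ∀ {v w} → Conn edge B v w → Conn edge A v w
  Conn-mono B⊆A = Star.map λ (j , j∈B , v∈j , w∈j) → j , B⊆A j∈B , v∈j , w∈j

  module Coarsening {A B cA cB} (B⊆A : B ⊆ A)
                    (NA : IsNumComponents edge A cA) (NB : IsNumComponents edge B cB) where

    coarsen : Fin cB → Fin cA
    coarsen y = proj₁ NA (proj₁ (proj₁ (proj₂ NB) y))

    coarsen-label : ∀ v → coarsen (proj₁ NB v) ≡ proj₁ NA v
    coarsen-label v = proj₂ (proj₂ (proj₂ NA) _ v)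
      (Conn-mono B⊆A (proj₁ (proj₂ (proj₂ NB) _ v) (proj₂ (proj₁ (proj₂ NB) (proj₁ NB v)))))

    coarsen-surjective : StrictlySurjective _≡_ coarsen
    coarsen-surjective y = proj₁ NB (proj₁ (proj₁ (proj₂ NA) y)) ,
                           trans (coarsen-label _) (proj₂ (proj₁ (proj₂ NA) y))

  components-antitone : ∀ {A B cA cB} → B ⊆ A →
    IsNumComponents edge A cA → IsNumComponents edge B cB → cA ℕ.≤ cB
  components-antitone B⊆A NA NB = surjective⇒≥ coarsen-surjective
    where open Coarsening B⊆A NA NB

  private-isolated : ∀ {A f v u} → ¬ InVWithout edge A f v → Conn edge (A - f) v u → v ≡ u
  private-isolated v-private ε = refl
  private-isolated v-private ((j , j∈A-f , v∈j , _) ◅ _) =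
    ⊥-elim (v-private (j , proj₁ (x∈p-y⇒x∈p×x≢y j∈A-f) , proj₂ (x∈p-y⇒x∈p×x≢y j∈A-f) , v∈j))

  -- u and v are joined by f in A, but in A - f the vertex v is isolated.
  components-remove-private : ∀ {A f u v cA cB} → f ∈ A → u ∈ edge f → v ∈ edge f → u ≢ v →
    ¬ InVWithout edge A f v →
    IsNumComponents edge A cA → IsNumComponents edge (A - f) cB → suc cA ℕ.≤ cB
  components-remove-private {A} {f} {u} {v} {cA} {cB} f∈A u∈f v∈f u≢v v-private NA NB =
    subst (ℕ._≤ cB) (trans (cong (cA ℕ.+_) (∣⁅x⁆∣≡1 (hB u))) (ℕP.+-comm cA 1))
      (surjective-collapse-≤ coarsen-surjective (hB v) ⁅ hB u ⁆ collapse)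
    where
    open Coarsening (p─q⊆p A ⁅ f ⁆) NA NB
    hB = proj₁ NB
    collapse : ∀ {y} → y ∈ ⁅ hB u ⁆ → y ≢ hB v × coarsen y ≡ coarsen (hB v)
    collapse y∈ with x∈⁅y⁆⇒x≡y _ y∈
    ... | refl =
      (λ hBu≡hBv → u≢v (sym (private-isolated v-private (proj₁ (proj₂ (proj₂ NB) v u) (sym hBu≡hBv))))) ,
      trans (coarsen-label u)
        (trans (proj₂ (proj₂ (proj₂ NA) u v) ((f , f∈A , u∈f , v∈f) ◅ ε)) (sym (coarsen-label v)))

  components-edge-≤ : ∀ {A f v c} → f ∈ A → v ∈ edge f →
    IsNumComponents edge A c → c ℕ.+ ∣ edge f - v ∣ ℕ.≤ n
  components-edge-≤ {f = f} {v} f∈A v∈f (h , h-surj , h-fibres) =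
    surjective-collapse-≤ h-surj v (edge f - v) λ y∈f-v →
    proj₂ (x∈p-y⇒x∈p×x≢y y∈f-v) , proj₂ (h-fibres _ _) ((f , f∈A , proj₁ (x∈p-y⇒x∈p×x≢y y∈f-v) , v∈f) ◅ ε)

-- δ-cycles and private vertices

  InVWithout? : ∀ F j v → Dec (InVWithout edge F j v)
  InVWithout? F j v = any? λ j′ → j′ ∈? F ×-dec ¬? (j′ ≟ j) ×-dec v ∈? edge j′

  DeltaCond? : Decidable (DeltaCond edge)
  DeltaCond? F = all? λ j → j ∈? F →-dec all? λ v → v ∈? edge j →-dec InVWithout? F j v

  HasPrivateVertex : Subset m → Set
  HasPrivateVertex A = ∃ λ f → f ∈ A × ∃ λ v → v ∈ edge f × ¬ InVWithout edge A f v

  HasPrivateVertex⊎DeltaCond : ∀ A → HasPrivateVertex A ⊎ DeltaCond edge A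
  HasPrivateVertex⊎DeltaCond A
    with any? (λ f → f ∈? A ×-dec any? λ v → v ∈? edge f ×-dec ¬? (InVWithout? A f v))
  ... | yes has-private = inj₁ has-private
  ... | no  ∄private    = inj₂ λ j j∈A v v∈j →
    decidable-stable (InVWithout? A j v) λ v-private → ∄private (j , j∈A , v , v∈j , v-private)

  deltaCycle-⊆ : ∀ {F} → Nonempty F → DeltaCond edge F → ∃ λ C → C ⊆ F × IsDeltaCycle edge C
  deltaCycle-⊆ F≢∅ F-delta with ⊆-minimal (λ F → nonempty? F ×-dec DeltaCond? F) (F≢∅ , F-delta)
  ... | C , C⊆F , (C≢∅ , C-delta) , C-minimal =
    C , C⊆F , C≢∅ , C-delta , λ C′ C′⊆C C′≢∅ C′-delta → C-minimal C′ C′⊆C (C′≢∅ , C′-delta)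

  brokenDeltaCycle-⊆ : ∀ (η : Fin m → Fin m) {C} → IsDeltaCycle edge C →
                       ∃ λ B → IsBrokenDeltaCycle edge η B × B ⊆ C
  brokenDeltaCycle-⊆ η {C} C-cycle with ∃-argmin (toℕ ∘ η) (proj₁ C-cycle)
  ... | j , j∈C , j-min = C - j , (C , C-cycle , j , j∈C , j-min , refl) , p─q⊆p C ⁅ j ⁆

  NB-⊆ : ∀ {η A B} → IsNB edge η A → B ⊆ A → IsNB edge η B
  NB-⊆ A-nb B⊆A D D-broken D⊆B = A-nb D D-broken (⊆-trans D⊆B B⊆A)

  NB⇒HasPrivateVertex : ∀ {η A} → IsNB edge η A → Nonempty A → HasPrivateVertex A
  NB⇒HasPrivateVertex {η} {A} A-nb A≢∅ with HasPrivateVertex⊎DeltaCond A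
  ... | inj₁ has-private = has-private
  ... | inj₂ A-delta with deltaCycle-⊆ A≢∅ A-delta
  ...   | C , C⊆A , C-cycle with brokenDeltaCycle-⊆ η C-cycle
  ...     | B , B-broken , B⊆C = ⊥-elim (A-nb B B-broken (⊆-trans B⊆C C⊆A))

  NB-components-≤ : ∀ {r η} {c : Subset m → ℕ} → (∀ A → IsNumComponents edge A (c A)) →
    IsUniform edge r → EdgesAtLeast2 edge →
    ∀ {A} t → IsNB edge η A → ∣ A ∣ ≡ suc t → c A ℕ.+ t ℕ.+ r ℕ.≤ suc n
  NB-components-≤ {r} {c = c} comps uniform ≥2 {A} zero A-nb ∣A∣≡1
    with ∣p∣>0⇒Nonempty A (subst (0 ℕ.<_) (sym ∣A∣≡1) ℕP.0<1+n)
  ... | f , f∈A with ∣p∣>0⇒Nonempty (edge f) (ℕP.<-≤-trans ℕP.0<1+n (≥2 f))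
  ...   | v , v∈f = begin
    c A ℕ.+ 0 ℕ.+ r                ≡⟨ cong (ℕ._+ r) (ℕP.+-identityʳ (c A)) ⟩
    c A ℕ.+ r                      ≡⟨ cong (c A ℕ.+_) (trans (sym (uniform f)) (sym (x∈p⇒suc∣p-x∣≡∣p∣ v∈f))) ⟩
    c A ℕ.+ suc ∣ edge f - v ∣     ≡⟨ ℕP.+-suc (c A) _ ⟩
    suc (c A ℕ.+ ∣ edge f - v ∣)   ≤⟨ s≤s (components-edge-≤ f∈A v∈f (comps A)) ⟩
    suc n                          ∎
    where open ℕP.≤-Reasoning
  NB-components-≤ {r} {c = c} comps uniform ≥2 {A} (suc t) A-nb ∣A∣≡2+t
    with NB⇒HasPrivateVertex A-nb (∣p∣>0⇒Nonempty A (subst (0 ℕ.<_) (sym ∣A∣≡2+t) ℕP.0<1+n))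
  ... | f , f∈A , v , v∈f , v-private with ∣p∣≥2⇒∃≢ (≥2 f) v∈f
  ...   | u , u∈f , u≢v = begin
    c A ℕ.+ suc t ℕ.+ r            ≡⟨ cong (ℕ._+ r) (ℕP.+-suc (c A) t) ⟩
    suc (c A) ℕ.+ t ℕ.+ r          ≤⟨ ℕP.+-monoˡ-≤ r (ℕP.+-monoˡ-≤ t (components-remove-private
                                        f∈A u∈f v∈f u≢v v-private (comps A) (comps (A - f)))) ⟩
    c (A - f) ℕ.+ t ℕ.+ r          ≤⟨ NB-components-≤ comps uniform ≥2 t (NB-⊆ A-nb (p─q⊆p A ⁅ f ⁆))
                                        (ℕP.suc-injective (trans (x∈p⇒suc∣p-x∣≡∣p∣ f∈A) ∣A∣≡2+t)) ⟩
    suc n                          ∎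
    where open ℕP.≤-Reasoning

-- Double counting

-- Each A of size s + 1 yields the s sets A - f (f ≠ e) of size s, of no smaller weight,
-- and each B of size s arises in this way from at most m - s sets A = B ∪ {f}.
double-count : ∀ {m} {P : Subset m → Set} → (∀ {A f} → P A → P (A - f)) →
  (e : Fin m) (w : Subset m → ℚ) → (∀ A → 0ℚ ℚ.≤ w A) → (∀ A f → w A ℚ.≤ w (A - f)) →
  ∀ s {L₁ L₂} →
  Enumerates (λ A → P A × e ∈ A × ∣ A ∣ ≡ s) L₁ → Enumerates (λ A → P A × e ∈ A × ∣ A ∣ ≡ suc s) L₂ →
  toℚ s ℚ.* ∑[ A ∈ L₂ ] w A ℚ.≤ toℚ (m ∸ s) ℚ.* ∑[ B ∈ L₁ ] w B
double-count {m} P-⊆ e w 0≤w w-antitone s {L₁} {L₂} (_ , L₁-enum) (!L₂ , L₂-enum) = begin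
  toℚ s ℚ.* ∑[ A ∈ L₂ ] w A                               ≡⟨ *-distribˡ-∑ L₂ (toℚ s) w ⟩
  ∑[ A ∈ L₂ ] (toℚ s ℚ.* w A)                             ≤⟨ ∑-mono-≤ L₂ remove-each ⟩
  ∑[ A ∈ L₂ ] sum (λ f → mask (A - e) (w (A - f)) f)
    ≡⟨ ∑-sum-comm L₂ (λ A f → mask (A - e) (w (A - f)) f) ⟩
  sum (λ f → ∑[ A ∈ L₂ ] mask (A - e) (w (A - f)) f)      ≤⟨ sum-mono-≤ remove-injective ⟩
  sum (λ f → ∑[ B ∈ L₁ ] mask (∁ B) (w B) f)              ≡⟨ ∑-sum-comm L₁ (λ B → mask (∁ B) (w B)) ⟨
  ∑[ B ∈ L₁ ] sum (mask (∁ B) (w B))                      ≤⟨ ∑-mono-≤ L₁ (ℚP.≤-reflexive ∘ add-each) ⟩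
  ∑[ B ∈ L₁ ] (toℚ (m ∸ s) ℚ.* w B)                       ≡⟨ *-distribˡ-∑ L₁ (toℚ (m ∸ s)) w ⟨
  toℚ (m ∸ s) ℚ.* ∑[ B ∈ L₁ ] w B                         ∎
  where
  open ℚP.≤-Reasoning

  remove-each : ∀ {A} → A ∈ₗ L₂ → toℚ s ℚ.* w A ℚ.≤ sum (λ f → mask (A - e) (w (A - f)) f)
  remove-each {A} A∈L₂ with proj₁ (L₂-enum A) A∈L₂
  ... | _ , e∈A , ∣A∣≡1+s = begin
    toℚ s ℚ.* w A              ≡⟨ cong (λ z → toℚ z ℚ.* w A) ∣A-e∣≡s ⟨
    toℚ ∣ A - e ∣ ℚ.* w A      ≡⟨ sum-mask (A - e) (w A) ⟨
    sum (mask (A - e) (w A))   ≤⟨ sum-mono-≤ (λ f → mask-mono-≤ (A - e) f (w-antitone A f)) ⟩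
    sum (λ f → mask (A - e) (w (A - f)) f) ∎
    where
    ∣A-e∣≡s : ∣ A - e ∣ ≡ s
    ∣A-e∣≡s = ℕP.suc-injective (trans (x∈p⇒suc∣p-x∣≡∣p∣ e∈A) ∣A∣≡1+s)

  remove-injective : ∀ f → ∑[ A ∈ L₂ ] mask (A - e) (w (A - f)) f ℚ.≤ ∑[ B ∈ L₁ ] mask (∁ B) (w B) f
  remove-injective f = ∑-≤-injection L₂ L₁ (λ A → lookup (A - e) f) (_- f) (λ A → w (A - f))
    (λ B → mask (∁ B) (w B) f) !L₂ (λ B → mask-nonNeg (∁ B) f (0≤w B)) maps injective
    where
    maps : ∀ {A} → A ∈ₗ L₂ → lookup (A - e) f ≡ true →
           A - f ∈ₗ L₁ × w (A - f) ℚ.≤ mask (∁ (A - f)) (w (A - f)) f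
    maps {A} A∈L₂ f∈A-e with proj₁ (L₂-enum A) A∈L₂ | x∈p-y⇒x∈p×x≢y (lookup⇒[]= f (A - e) f∈A-e)
    ... | A-P , e∈A , ∣A∣≡1+s | f∈A , f≢e =
      proj₂ (L₁-enum (A - f)) (P-⊆ A-P , x∈p∧x≢y⇒x∈p-y e∈A (≢-sym f≢e) ,
                               ℕP.suc-injective (trans (x∈p⇒suc∣p-x∣≡∣p∣ f∈A) ∣A∣≡1+s)) ,
      subst (λ b → w (A - f) ℚ.≤ (if b then w (A - f) else 0ℚ)) (sym f∈∁[A-f]) ℚP.≤-refl
      where
      f∈∁[A-f] : lookup (∁ (A - f)) f ≡ true
      f∈∁[A-f] = []=⇒lookup (x∉p⇒x∈∁p (x∉p-x A f))
    injective : ∀ {A A′} → A ∈ₗ L₂ → A′ ∈ₗ L₂ → lookup (A - e) f ≡ true → lookup (A′ - e) f ≡ true →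
                A - f ≡ A′ - f → A ≡ A′
    injective _ _ f∈A-e f∈A′-e = p-x≡q-x⇒p≡q
      (proj₁ (x∈p-y⇒x∈p×x≢y (lookup⇒[]= f _ f∈A-e))) (proj₁ (x∈p-y⇒x∈p×x≢y (lookup⇒[]= f _ f∈A′-e)))

  add-each : ∀ {B} → B ∈ₗ L₁ → sum (mask (∁ B) (w B)) ≡ toℚ (m ∸ s) ℚ.* w B
  add-each {B} B∈L₁ with proj₁ (L₁-enum B) B∈L₁
  ... | _ , _ , ∣B∣≡s = trans (sum-mask (∁ B) (w B))
    (cong (λ z → toℚ z ℚ.* w B) (trans (∣∁p∣≡n∸∣p∣ B) (cong (m ∸_) ∣B∣≡s)))

-- a and b play the roles of 1 / (1 + x) and 1 / (1 + y).
deficit-bound : ∀ (x y a b N K S₁ S₂ : ℚ) →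
  (1ℚ ℚ.+ x) ℚ.* a ≡ 1ℚ → (1ℚ ℚ.+ y) ℚ.* b ≡ 1ℚ → 0ℚ ℚ.≤ x → 0ℚ ℚ.≤ a → 0ℚ ℚ.≤ b →
  (1ℚ ℚ.+ y) ℚ.* S₂ ℚ.≤ (1ℚ ℚ.+ x) ℚ.* S₁ → S₂ ℚ.≤ N ℚ.* K →
  ℚ.- (x ℚ.* N ℚ.* a) ℚ.* K ℚ.≤ S₁ ℚ.* b ℚ.- S₂
deficit-bound x y a b N K S₁ S₂ [1+x]a≡1 [1+y]b≡1 0≤x 0≤a 0≤b [1+y]S₂≤[1+x]S₁ S₂≤NK = begin
  ℚ.- (x ℚ.* N ℚ.* a) ℚ.* K
    ≡⟨ solve 4 (λ x N a K → :- (x :* N :* a) :* K := :- (x :* a) :* (N :* K)) refl x N a K ⟩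
  ℚ.- (x ℚ.* a) ℚ.* (N ℚ.* K)
    ≤⟨ ℚP.*-monoˡ-≤-nonPos (ℚ.- (x ℚ.* a)) {{ℚ.nonPositive (ℚP.neg-antimono-≤ 0≤xa)}} S₂≤NK ⟩
  ℚ.- (x ℚ.* a) ℚ.* S₂
    ≡⟨ solve 3 (λ x a S → :- (x :* a) :* S := S :* a :- S :* ((con 1ℚ :+ x) :* a)) refl x a S₂ ⟩
  S₂ ℚ.* a ℚ.- S₂ ℚ.* ((1ℚ ℚ.+ x) ℚ.* a)
    ≡⟨ cong (λ z → S₂ ℚ.* a ℚ.- S₂ ℚ.* z) [1+x]a≡1 ⟩
  S₂ ℚ.* a ℚ.- S₂ ℚ.* 1ℚ
    ≡⟨ cong (λ z → S₂ ℚ.* a ℚ.- z) (ℚP.*-identityʳ S₂) ⟩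
  S₂ ℚ.* a ℚ.- S₂
    ≤⟨ ℚP.+-monoˡ-≤ (ℚ.- S₂) S₂a≤S₁b ⟩
  S₁ ℚ.* b ℚ.- S₂ ∎
  where
  open ℚP.≤-Reasoning
  open ℚSolver.+-*-Solver
  0≤xa : 0ℚ ℚ.≤ x ℚ.* a
  0≤xa = subst (ℚ._≤ x ℚ.* a) (ℚP.*-zeroˡ a) (ℚP.*-monoʳ-≤-nonNeg a {{ℚ.nonNegative 0≤a}} 0≤x)
  0≤ab : 0ℚ ℚ.≤ a ℚ.* b
  0≤ab = subst (ℚ._≤ a ℚ.* b) (ℚP.*-zeroˡ b) (ℚP.*-monoʳ-≤-nonNeg b {{ℚ.nonNegative 0≤b}} 0≤a)
  S₂a≤S₁b : S₂ ℚ.* a ℚ.≤ S₁ ℚ.* b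
  S₂a≤S₁b = begin
    S₂ ℚ.* a                                 ≡⟨ ℚP.*-identityʳ (S₂ ℚ.* a) ⟨
    S₂ ℚ.* a ℚ.* 1ℚ                          ≡⟨ cong (S₂ ℚ.* a ℚ.*_) [1+y]b≡1 ⟨
    S₂ ℚ.* a ℚ.* ((1ℚ ℚ.+ y) ℚ.* b)
      ≡⟨ solve 4 (λ S a y b → S :* a :* ((con 1ℚ :+ y) :* b) := (con 1ℚ :+ y) :* S :* (a :* b)) refl S₂ a y b ⟩
    (1ℚ ℚ.+ y) ℚ.* S₂ ℚ.* (a ℚ.* b)
      ≤⟨ ℚP.*-monoʳ-≤-nonNeg (a ℚ.* b) {{ℚ.nonNegative 0≤ab}} [1+y]S₂≤[1+x]S₁ ⟩
    (1ℚ ℚ.+ x) ℚ.* S₁ ℚ.* (a ℚ.* b)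
      ≡⟨ solve 4 (λ S a x b → (con 1ℚ :+ x) :* S :* (a :* b) := S :* b :* ((con 1ℚ :+ x) :* a)) refl S₁ a x b ⟩
    S₁ ℚ.* b ℚ.* ((1ℚ ℚ.+ x) ℚ.* a)          ≡⟨ cong (S₁ ℚ.* b ℚ.*_) [1+x]a≡1 ⟩
    S₁ ℚ.* b ℚ.* 1ℚ                          ≡⟨ ℚP.*-identityʳ (S₁ ℚ.* b) ⟩
    S₁ ℚ.* b                                 ∎

exponent-≤ : ∀ a t r n → a ℕ.+ t ℕ.+ r ℕ.≤ suc n →
             + a ℤ.- + 1 ℤ.- (+ n ℤ.- + r) ℤ.≤ ℤ.- (+ suc t) ℤ.+ + 1
exponent-≤ a t r n a+t+r≤1+n = begin
  + a ℤ.- + 1 ℤ.- (+ n ℤ.- + r)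
    ≡⟨ solve 4 (λ a t r n → a :- con (+ 1) :- (n :- r)
                          := (:- (con (+ 1) :+ t) :+ con (+ 1)) :+ ((a :+ t :+ r) :- (con (+ 1) :+ n)))
               refl (+ a) (+ t) (+ r) (+ n) ⟩
  (ℤ.- (+ suc t) ℤ.+ + 1) ℤ.+ (+ (a ℕ.+ t ℕ.+ r) ℤ.- + suc n)
    ≤⟨ ℤP.+-monoʳ-≤ (ℤ.- (+ suc t) ℤ.+ + 1) (ℤP.i≤j⇒i-j≤0 (ℤ.+≤+ a+t+r≤1+n)) ⟩
  (ℤ.- (+ suc t) ℤ.+ + 1) ℤ.+ + 0 ≡⟨ ℤP.+-identityʳ _ ⟩
  ℤ.- (+ suc t) ℤ.+ + 1 ∎
  where
  open ℤP.≤-Reasoning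
  open ℤSolver.+-*-Solver

m∸n≡suc[m∸suc[n]] : ∀ m n → suc n ℕ.≤ m → m ∸ n ≡ suc (m ∸ suc n)
m∸n≡suc[m∸suc[n]] (suc m) zero    _           = refl
m∸n≡suc[m∸suc[n]] (suc m) (suc n) (s≤s 1+n≤m) = m∸n≡suc[m∸suc[n]] m n 1+n≤m

lemma3p3 : ∀ {n m r : ℕ} (edge : Fin m → Subset n) →
    IsUniform edge r → EdgesAtLeast2 edge → Sperner edge →
    5 ℕ.≤ m →
    (η : Fin m → Fin m) → Bijective _≡_ _≡_ η →
    (e : Fin m) → (k : ℕ) → .{{_ : NonZero k}} →
    (i : ℕ) → 2 ℕ.≤ i → 2 ℕ.* i ℕ.≤ m →
    (c : Subset m → ℕ) → (∀ A → IsNumComponents edge A (c A)) →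
    (L₁ L₂ : List (Subset m)) →
    Enumerates (IsNBj edge η (2 ℕ.* i ∸ 1) e) L₁ →
    Enumerates (IsNBj edge η (2 ℕ.* i) e) L₂ →
    ℚ.- ((+ ((m ∸ 2 ℕ.* i) ℕ.* length L₂)) ℚ./ suc (m ∸ 2 ℕ.* i))
        ℚ.* kpow k (ℤ.- (+ (2 ℕ.* i)) ℤ.+ + 1)
      ℚ.≤
    sumℚ (map (λ A → kpow k ((+ c A) ℤ.- + 1 ℤ.- ((+ n) ℤ.- (+ r)))) L₁)
        ℚ.* ((+ 1) ℚ./ suc (2 ℕ.* i ∸ 2))
      ℚ.- sumℚ (map (λ A → kpow k ((+ c A) ℤ.- + 1 ℤ.- ((+ n) ℤ.- (+ r)))) L₂)
lemma3p3 {n} {m} {r} edge uniform ≥2 _ _ η _ e k i (s≤s (s≤s _)) 2i≤m c comps L₁ L₂ L₁-enum L₂-enum =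
  subst (λ z → ℚ.- z ℚ.* K ℚ.≤ ∑[ A ∈ L₁ ] w A ℚ.* (+ 1 ℚ./ suc q) ℚ.- ∑[ A ∈ L₂ ] w A) (sym (/suc-as-* p N p))
    (deficit-bound (toℚ p) (toℚ q) (+ 1 ℚ./ suc p) (+ 1 ℚ./ suc q) (toℚ N) K _ _
      (1+toℚ-*-inverse p) (1+toℚ-*-inverse q)
      (0≤/ p 1) (0≤/ 1 (suc p)) (0≤/ 1 (suc q)) counted weights-≤)
  where
  p = m ∸ 2 ℕ.* i
  q = 2 ℕ.* i ∸ 2
  N = length L₂
  K = kpow k (ℤ.- (+ (2 ℕ.* i)) ℤ.+ + 1)
  exponent : Subset m → ℤ
  exponent A = + c A ℤ.- + 1 ℤ.- (+ n ℤ.- + r)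
  w : Subset m → ℚ
  w A = kpow k (exponent A)

  w-antitone : ∀ A f → w A ℚ.≤ w (A - f)
  w-antitone A f = kpow-mono-≤ k (ℤP.+-monoˡ-≤ (ℤ.- (+ n ℤ.- + r)) (ℤP.+-monoˡ-≤ (ℤ.- + 1)
    (ℤ.+≤+ (components-antitone edge (p─q⊆p A ⁅ f ⁆) (comps A) (comps (A - f))))))

  counted : (1ℚ ℚ.+ toℚ q) ℚ.* ∑[ A ∈ L₂ ] w A ℚ.≤ (1ℚ ℚ.+ toℚ p) ℚ.* ∑[ B ∈ L₁ ] w B
  counted = subst₂ (λ x y → x ℚ.* ∑[ A ∈ L₂ ] w A ℚ.≤ y ℚ.* ∑[ B ∈ L₁ ] w B) (toℚ-suc q)
    (trans (cong toℚ (m∸n≡suc[m∸suc[n]] m (suc q) 2i≤m)) (toℚ-suc p))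
    (double-count (λ A-nb → NB-⊆ edge A-nb (p─q⊆p _ _)) e w (kpow-nonNeg k ∘ exponent) w-antitone
                  (suc q) L₁-enum L₂-enum)

  weights-≤ : ∑[ A ∈ L₂ ] w A ℚ.≤ toℚ N ℚ.* K
  weights-≤ = ℚP.≤-trans (∑-mono-≤ L₂ w≤K) (ℚP.≤-reflexive (∑-const L₂ K))
    where
    w≤K : ∀ {A} → A ∈ₗ L₂ → w A ℚ.≤ K
    w≤K {A} A∈L₂ with proj₁ (proj₂ L₂-enum A) A∈L₂
    ... | A-nb , _ , ∣A∣≡2i = kpow-mono-≤ k (exponent-≤ (c A) (suc q) r n
      (NB-components-≤ edge comps uniform ≥2 (suc q) A-nb ∣A∣≡2i))
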